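{- Let $r\geq 3$ and let $G$ be a linear $r$-graph. Let $B\subseteq \partial_2(G)$ be such that every edge of $G$ contains at most one edge of $B$. Then the default edge-coloring $\phi$ of $B$ is strongly proper.
   Context: An $r$-graph is an $r$-uniform hypergraph; it is linear if any two distinct edges share at most one vertex. The 2-shadow $\partial_2(G)$ is the graph of all pairs $\{a,b\}$ contained in some edge of $G$; when $G$ is linear each such pair lies in a unique edge of $G$. The default edge-coloring $\phi$ of $\partial_2(G)$ assigns to $\{a,b\}$ the $(r-2)$-set $e\setminus\{a,b\}$, where $e$ is the unique edge of $G$ containing $\{a,b\}$; the default coloring of $B\subseteq\partial_2(G)$ is its restriction to $B$. An edge-coloring of a graph by sets is strongly proper if any two distinct edges sharing a vertex receive disjoint color sets. -}

module Defs where

open import Data.Nat using (ℕ; _≤_)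
open import Data.Fin using (Fin)
open import Data.Fin.Subset using (Subset; _∈_; _⊆_; _∩_; _─_; ∣_∣; Empty)
open import Data.Product using (Σ; ∃; _×_)
open import Relation.Binary.PropositionalEquality using (_≡_; _≢_)

Hypergraph : ℕ → Set₁
Hypergraph n = Subset n → Set

IsUniform : ∀ {n} → ℕ → Hypergraph n → Set
IsUniform r G = ∀ e → G e → ∣ e ∣ ≡ r

IsLinear : ∀ {n} → Hypergraph n → Set
IsLinear G = ∀ e f → G e → G f → e ≢ f → ∣ e ∩ f ∣ ≤ 1

InShadow : ∀ {n} → Hypergraph n → Subset n → Set
InShadow G p = (∣ p ∣ ≡ 2) × (∃ λ e → G e × p ⊆ e)

-- c is the default colour of the shadow edge p: c = e ∖ p for the
-- (unique, by linearity) edge e of G containing p.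
DefaultColour : ∀ {n} → Hypergraph n → Subset n → Subset n → Set
DefaultColour G p c = ∃ λ e → G e × p ⊆ e × c ≡ e ─ p

StronglyProper : ∀ {n} → (Subset n → Set) → (Subset n → Subset n → Set) → Set
StronglyProper B col =
  ∀ p q → B p → B q → p ≢ q → (∃ λ v → v ∈ p × v ∈ q) →
  ∀ c d → col p c → col q d → Empty (c ∩ d)

-- A colour vertex x shared by the default colours e ∖ p and f ∖ q lies in both
-- edges e and f, and so does a common vertex v of p and q; as x ∉ p we have
-- x ≠ v, so linearity forces e = f. Then p and q both lie in the edge e, which
-- contains at most one edge of B, so p = q.
module Submission where

open import Defs
open import Data.Nat using (ℕ; _≤_; z≤n; s≤s)
open import Data.Nat.Properties using (m≤n⇒m≤1+n; ≤-trans; <-irrefl)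
open import Data.Fin using (Fin; zero; suc)
open import Data.Fin.Subset using (Subset; _⊆_; _∈_; _∉_; _─_; _∩_; ∣_∣; inside; outside)
open import Data.Fin.Subset.Properties using (x∈p∩q⁻; x∈p∩q⁺)
open import Data.Vec using (_∷_; here; there)
open import Data.Vec.Properties using (≡-dec)
open import Data.Bool.Properties using () renaming (_≟_ to _≟ᵇ_)
open import Data.Product using (_,_; _×_)
open import Data.Empty using (⊥-elim)
open import Function using (_∘_)
open import Relation.Nullary using (yes; no)
open import Relation.Binary.PropositionalEquality using (_≡_; _≢_; refl; cong; subst)

x∈p─q⁻ : ∀ {n} {x : Fin n} (p q : Subset n) → x ∈ p ─ q → x ∈ p × x ∉ q
x∈p─q⁻            (inside ∷ _)  (outside ∷ _) here = here , λ ()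
x∈p─q⁻ {x = zero} (inside ∷ _)  (inside ∷ _)  ()
x∈p─q⁻ {x = zero} (outside ∷ _) (inside ∷ _)  ()
x∈p─q⁻ {x = zero} (outside ∷ _) (outside ∷ _) ()
x∈p─q⁻            (_ ∷ p)       (_ ∷ q)       (there x∈p─q) with x∈p─q⁻ p q x∈p─q
... | x∈p , x∉q = there x∈p , λ { (there x∈q) → x∉q x∈q }

x∈p⇒1≤∣p∣ : ∀ {n} {x : Fin n} {p : Subset n} → x ∈ p → 1 ≤ ∣ p ∣
x∈p⇒1≤∣p∣                        here       = s≤s z≤n
x∈p⇒1≤∣p∣ {p = outside ∷ p} (there x∈p) = x∈p⇒1≤∣p∣ x∈p
x∈p⇒1≤∣p∣ {p = inside ∷ p}  (there _)   = s≤s z≤n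

x∈p∧y∈p∧x≢y⇒2≤∣p∣ : ∀ {n} {x y : Fin n} {p : Subset n} →
  x ∈ p → y ∈ p → x ≢ y → 2 ≤ ∣ p ∣
x∈p∧y∈p∧x≢y⇒2≤∣p∣ here        here        x≢y = ⊥-elim (x≢y refl)
x∈p∧y∈p∧x≢y⇒2≤∣p∣ here        (there y∈p) _   = s≤s (x∈p⇒1≤∣p∣ y∈p)
x∈p∧y∈p∧x≢y⇒2≤∣p∣ (there x∈p) here        _   = s≤s (x∈p⇒1≤∣p∣ x∈p)
x∈p∧y∈p∧x≢y⇒2≤∣p∣ {p = outside ∷ p} (there x∈p) (there y∈p) x≢y =
  x∈p∧y∈p∧x≢y⇒2≤∣p∣ x∈p y∈p (x≢y ∘ cong suc)
x∈p∧y∈p∧x≢y⇒2≤∣p∣ {p = inside ∷ p}  (there x∈p) (there y∈p) x≢y =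
  m≤n⇒m≤1+n (x∈p∧y∈p∧x≢y⇒2≤∣p∣ x∈p y∈p (x≢y ∘ cong suc))

linear-edges-sharing-two-vertices-equal : ∀ {n} {G : Hypergraph n} → IsLinear G →
  ∀ {e f x y} → G e → G f → x ∈ e → x ∈ f → y ∈ e → y ∈ f → x ≢ y → e ≡ f
linear-edges-sharing-two-vertices-equal lin {e} {f} Ge Gf x∈e x∈f y∈e y∈f x≢y
  with ≡-dec _≟ᵇ_ e f
... | yes e≡f = e≡f
... | no e≢f  = ⊥-elim (<-irrefl refl (≤-trans two-shared (lin e f Ge Gf e≢f)))
  where
  two-shared : 2 ≤ ∣ e ∩ f ∣
  two-shared = x∈p∧y∈p∧x≢y⇒2≤∣p∣ (x∈p∩q⁺ (x∈e , x∈f)) (x∈p∩q⁺ (y∈e , y∈f)) x≢y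

lemma3p3 : (n r : ℕ) → 3 ≤ r → (G : Hypergraph n) → IsUniform r G → IsLinear G →
    (B : Subset n → Set) → (∀ p → B p → InShadow G p) →
    (∀ e → G e → ∀ p q → B p → B q → p ⊆ e → q ⊆ e → p ≡ q) →
    StronglyProper B (DefaultColour G)
lemma3p3 n r _ G _ lin B _ one-per-edge p q Bp Bq p≢q (v , v∈p , v∈q) c d
  (e , Ge , p⊆e , c≡e─p) (f , Gf , q⊆f , d≡f─q) (x , x∈c∩d)
  with x∈p∩q⁻ c d x∈c∩d
... | x∈c , x∈d with x∈p─q⁻ e p (subst (x ∈_) c≡e─p x∈c)
                   | x∈p─q⁻ f q (subst (x ∈_) d≡f─q x∈d)
... | x∈e , x∉p | x∈f , _ with linear-edges-sharing-two-vertices-equal lin Ge Gf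
                               x∈e x∈f (p⊆e v∈p) (q⊆f v∈q) (λ { refl → x∉p v∈p })
... | refl = p≢q (one-per-edge e Ge p q Bp Bq p⊆e q⊆f)
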